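{- Let $\Lambda$ be a symplectic lattice of type $(d_1,\dots,d_g)$ with $d_1=d_2=1$. Let $v,w$ be primitive vectors of $\Lambda$ with $[v^\ast]=[w^\ast]$ in $D_\Lambda$. Then there exists $\gamma\in\Gamma_\Lambda$ with $\gamma(v)=w$.
   Context: A symplectic lattice is a free $\mathbb{Z}$-module $\Lambda$ of rank $2g$ with a nondegenerate alternating bilinear form $(\cdot,\cdot)\colon\Lambda\times\Lambda\to\mathbb{Z}$. Let $U$ be the rank-2 lattice with Gram matrix $\begin{pmatrix}0&1\\-1&0\end{pmatrix}$ and $U(d)$ its form scaled by $d$. Every symplectic lattice is isometric to $U(d_1)\oplus\cdots\oplus U(d_g)$ with $d_i\mid d_{i+1}$; $(d_1,\dots,d_g)$ is its type. $\Lambda^\vee=\{v\in\Lambda\otimes\mathbb{Q}\mid (v,\Lambda)\subset\mathbb{Z}\}$, $D_\Lambda=\Lambda^\vee/\Lambda$. $\Gamma_\Lambda$ is the kernel of $\mathrm{Sp}(\Lambda)\to\mathrm{Sp}(D_\Lambda)$. A vector $v$ is primitive if $\mathbb{Q}v\cap\Lambda=\mathbb{Z}v$; then $\mathrm{div}(v)>0$ is defined by $(v,\Lambda)=\mathrm{div}(v)\mathbb{Z}$, $v^\ast=v/\mathrm{div}(v)$, and $[v^\ast]$ is its class in $D_\Lambda$. -}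

module Defs where

open import Data.Nat as ℕ using (ℕ; zero; suc)
open import Data.Integer as ℤ using (ℤ; +_; _+_; _-_; _*_; -_)
open import Data.Integer.Divisibility using (_∣_)
open import Data.Nat.Divisibility as ℕD using ()
open import Data.Fin using (Fin; zero; suc; inject₁)
open import Data.Product using (_×_; _,_; proj₁; proj₂; Σ; ∃)
open import Relation.Binary.PropositionalEquality using (_≡_)
open import Relation.Nullary using (¬_)

Σᶠ : ∀ {n} → (Fin n → ℤ) → ℤ
Σᶠ {zero}  f = + 0
Σᶠ {suc n} f = f zero + Σᶠ (λ i → f (suc i))

-- The underlying group ℤ^{2g} of the standard symplectic lattice
-- U(d₁) ⊕ ⋯ ⊕ U(d_g): the i-th summand has basis eᵢ, fᵢ; a vector is
-- given by its coordinates (xᵢ , yᵢ) = (coefficient of eᵢ, coefficient of fᵢ).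
Vec2 : ℕ → Set
Vec2 g = Fin g → ℤ × ℤ

module _ {g : ℕ} where

  _≋_ : Vec2 g → Vec2 g → Set
  u ≋ v = ∀ i → u i ≡ v i

  _⊕_ : Vec2 g → Vec2 g → Vec2 g
  (u ⊕ v) i = (proj₁ (u i) + proj₁ (v i) , proj₂ (u i) + proj₂ (v i))

  _⊖_ : Vec2 g → Vec2 g → Vec2 g
  (u ⊖ v) i = (proj₁ (u i) - proj₁ (v i) , proj₂ (u i) - proj₂ (v i))

  _·_ : ℤ → Vec2 g → Vec2 g
  (c · v) i = (c * proj₁ (v i) , c * proj₂ (v i))

  zeroV : Vec2 g
  zeroV i = (+ 0 , + 0)

  _∣V_ : ℤ → Vec2 g → Set
  n ∣V v = ∀ i → (n ∣ proj₁ (v i)) × (n ∣ proj₂ (v i))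

-- The alternating form of U(d₁) ⊕ ⋯ ⊕ U(d_g):
-- (eᵢ , fᵢ) = dᵢ, (fᵢ , eᵢ) = -dᵢ, all other pairings 0.
form : ∀ {g} → (Fin g → ℕ) → Vec2 g → Vec2 g → ℤ
form d v w = Σᶠ (λ i → (+ d i) * (proj₁ (v i) * proj₂ (w i) - proj₂ (v i) * proj₁ (w i)))

IsType : ∀ {k} → (Fin (suc k) → ℕ) → Set
IsType {k} d = (∀ i → 0 ℕ.< d i) × (∀ (i : Fin k) → d (inject₁ i) ℕD.∣ d (suc i))

module _ {g : ℕ} (d : Fin g → ℕ) where

  IsLinear : (Vec2 g → Vec2 g) → Set
  IsLinear γ = (∀ u v → γ (u ⊕ v) ≋ (γ u ⊕ γ v)) × (∀ c v → γ (c · v) ≋ (c · γ v))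

  InSp : (Vec2 g → Vec2 g) → Set
  InSp γ = IsLinear γ
         × (∃ λ (δ : Vec2 g → Vec2 g) → (∀ v → δ (γ v) ≋ v) × (∀ v → γ (δ v) ≋ v))
         × (∀ u v → form d (γ u) (γ v) ≡ form d u v)

  -- Γ_Λ = ker(Sp(Λ) → Sp(D_Λ)).  An element of Λ ⊗ ℚ is written x/n with
  -- x ∈ Λ, n > 0; it lies in Λ^∨ iff n ∣ (x, y) for all y ∈ Λ, and γ acts
  -- trivially on its class iff γ(x/n) - x/n = (γ x - x)/n ∈ Λ.
  InΓ : (Vec2 g → Vec2 g) → Set
  InΓ γ = InSp γ
        × (∀ (n : ℕ) (x : Vec2 g) → 0 ℕ.< n
             → (∀ y → (+ n) ∣ form d x y)
             → (+ n) ∣V (γ x ⊖ x))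

  Primitive : Vec2 g → Set
  Primitive v = (¬ (v ≋ zeroV))
              × (∀ (u : Vec2 g) (a b : ℤ) → ¬ (b ≡ + 0) → (b · u) ≋ (a · v)
                   → ∃ λ c → u ≋ (c · v))

  IsDiv : Vec2 g → ℕ → Set
  IsDiv v n = 0 ℕ.< n
            × (∀ y → (+ n) ∣ form d v y)
            × (∃ λ y → form d v y ≡ + n)

  -- [v/m] = [w/n] in D_Λ, i.e. v/m - w/n ∈ Λ, i.e. (n v - m w)/(m n) ∈ Λ.
  SameClass : Vec2 g → ℕ → Vec2 g → ℕ → Set
  SameClass v m w n = (+ (m ℕ.* n)) ∣V (((+ n) · v) ⊖ ((+ m) · w))

{-# OPTIONS --safe #-}
-- Γ_Λ contains every transvection x ↦ x + c (x,u) u, since for x ∈ nΛ^∨ the added vector lies in nΛ.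
-- As d₁ = 1 it also contains SL₂(ℤ) acting on the first summand U = ⟨e₀, f₀⟩ (index zero): the
-- U-coordinates of x ∈ nΛ^∨ are themselves divisible by n. For (e,a) = 0 three transvections compose
-- to the Eichler map x ↦ x + (x,e) a + (x,a) e.
--
-- Let div v = m and (v,y) = m. A Bézout matrix in SL₂(U) kills the f₀-coefficient of v; the Eichler
-- map along f₀ and the U^⊥-part of y, followed by a transvection in f₀, then raise it to (v,y) = m.
-- If x and r are in this normal form and x ≡ r mod m, then (x,e₀) = -m, so the Eichler map along e₀
-- and ρ = U^⊥-part of (x - r)/m turns the U^⊥-part of x into that of r, and a transvection in e₀
-- corrects the e₀-coefficient by a multiple of m. As Γ_Λ acts trivially on D_Λ, [v/m] = [w/m]
-- makes the normal forms of v and w congruent mod m. Primitivity gives div v = div w: from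
-- n v - m w ∈ mnΛ one gets m ∣ n and n ∣ m.
module Submission where

open import Defs
open import Data.Nat as ℕ using (ℕ; suc)
open import Data.Nat.Divisibility using (∣-antisym)
open import Data.Nat.GCD
  using (gcd; gcd[m,n]∣m; gcd[m,n]∣n; gcd[m,n]≡0⇒m≡0; gcd[m,n]≡0⇒n≡0; GCD-/gcd; module Bézout)
open import Data.Nat.DivMod using (_/_; m/n*n≡m)
open import Data.Fin using (Fin; zero; suc)
open import Data.Product using (_×_; _,_; proj₁; proj₂; ∃; ∃-syntax)
open import Data.Product.Properties using (×-≡,≡→≡)
open import Data.Integer as ℤ using (ℤ; +_; -[1+_]; _+_; _-_; _*_; -_)
import Data.Integer.Properties as ℤ
open import Data.Integer.Divisibility.Signed
  using (_∣_; divides; quotient; ∣ᵤ⇒∣; ∣⇒∣ᵤ; ∣m∣n⇒∣m+n; ∣m⇒∣-m; ∣n⇒∣m*n; *-cancelˡ-∣)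
open import Data.Integer.Tactic.RingSolver using (solve-∀)
open import Function using (_∘_)
open import Data.Empty using (⊥-elim)
open import Relation.Nullary using (¬_; yes; no)
open import Relation.Binary.PropositionalEquality
  using (_≡_; _≢_; refl; sym; trans; cong; cong₂; subst; subst₂; module ≡-Reasoning)

Σᶠ-cong : ∀ {n} {f h : Fin n → ℤ} → (∀ i → f i ≡ h i) → Σᶠ f ≡ Σᶠ h
Σᶠ-cong {ℕ.zero} eq = refl
Σᶠ-cong {suc n}  eq = cong₂ _+_ (eq zero) (Σᶠ-cong (eq ∘ suc))

Σᶠ-zero : ∀ {n} {f : Fin n → ℤ} → (∀ i → f i ≡ + 0) → Σᶠ f ≡ + 0
Σᶠ-zero {ℕ.zero} eq = refl
Σᶠ-zero {suc n}  eq = cong₂ _+_ (eq zero) (Σᶠ-zero (eq ∘ suc))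

Σᶠ-+ : ∀ {n} (f h : Fin n → ℤ) → Σᶠ (λ i → f i + h i) ≡ Σᶠ f + Σᶠ h
Σᶠ-+ {ℕ.zero} f h = refl
Σᶠ-+ {suc n}  f h =
  trans (cong (_+_ (f zero + h zero)) (Σᶠ-+ (f ∘ suc) (h ∘ suc)))
        (interchange (f zero) (h zero) (Σᶠ (f ∘ suc)) (Σᶠ (h ∘ suc)))
  where
  interchange : ∀ a b c e → a + b + (c + e) ≡ a + c + (b + e)
  interchange = solve-∀

Σᶠ-* : ∀ {n} c (f : Fin n → ℤ) → Σᶠ (λ i → c * f i) ≡ c * Σᶠ f
Σᶠ-* {ℕ.zero} c f = sym (ℤ.*-zeroʳ c)
Σᶠ-* {suc n}  c f =
  trans (cong (_+_ (c * f zero)) (Σᶠ-* c (f ∘ suc))) (sym (ℤ.*-distribˡ-+ c (f zero) _))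

Σᶠ-neg : ∀ {n} (f : Fin n → ℤ) → Σᶠ (λ i → - f i) ≡ - Σᶠ f
Σᶠ-neg {ℕ.zero} f = refl
Σᶠ-neg {suc n}  f =
  trans (cong (_+_ (- f zero)) (Σᶠ-neg (f ∘ suc))) (sym (ℤ.neg-distrib-+ (f zero) _))

module _ {g : ℕ} where

  ≋-refl : {x : Vec2 g} → x ≋ x
  ≋-refl i = refl

  ≋-trans : {x y z : Vec2 g} → x ≋ y → y ≋ z → x ≋ z
  ≋-trans x≋y y≋z i = trans (x≋y i) (y≋z i)

  ⊕-cong : {x x′ y y′ : Vec2 g} → x ≋ x′ → y ≋ y′ → (x ⊕ y) ≋ (x′ ⊕ y′)
  ⊕-cong x≋x′ y≋y′ i = cong₂ (λ p q → (proj₁ p + proj₁ q , proj₂ p + proj₂ q)) (x≋x′ i) (y≋y′ i)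

  ·-congˡ : ∀ {a b} {x : Vec2 g} → a ≡ b → (a · x) ≋ (b · x)
  ·-congˡ refl = ≋-refl

  -- Signed divisibility, so that quotients are at hand.
  infix 4 _∣ᵥ_

  _∣ᵥ_ : ℤ → Vec2 g → Set
  n ∣ᵥ x = ∀ i → n ∣ proj₁ (x i) × n ∣ proj₂ (x i)

  ∣ᵥ⇒∣V : ∀ {n} {x : Vec2 g} → n ∣ᵥ x → n ∣V x
  ∣ᵥ⇒∣V n∣x i = ∣⇒∣ᵤ (proj₁ (n∣x i)) , ∣⇒∣ᵤ (proj₂ (n∣x i))

  ∣V⇒∣ᵥ : ∀ {n} {x : Vec2 g} → n ∣V x → n ∣ᵥ x
  ∣V⇒∣ᵥ n∣x i = ∣ᵤ⇒∣ (proj₁ (n∣x i)) , ∣ᵤ⇒∣ (proj₂ (n∣x i))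

  ∣ᵥ-⊖-trans : ∀ {n} {x y z : Vec2 g} → n ∣ᵥ (x ⊖ y) → n ∣ᵥ (y ⊖ z) → n ∣ᵥ (x ⊖ z)
  ∣ᵥ-⊖-trans {x = x} {y} {z} n∣x-y n∣y-z i =
    subst (_ ∣_) (telescope (proj₁ (x i)) (proj₁ (y i)) (proj₁ (z i)))
      (∣m∣n⇒∣m+n (proj₁ (n∣x-y i)) (proj₁ (n∣y-z i))) ,
    subst (_ ∣_) (telescope (proj₂ (x i)) (proj₂ (y i)) (proj₂ (z i)))
      (∣m∣n⇒∣m+n (proj₂ (n∣x-y i)) (proj₂ (n∣y-z i)))
    where
    telescope : ∀ a b c → (a - b) + (b - c) ≡ a - c
    telescope = solve-∀

  ∣ᵥ-⊖-sym : ∀ {n} {x y : Vec2 g} → n ∣ᵥ (x ⊖ y) → n ∣ᵥ (y ⊖ x)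
  ∣ᵥ-⊖-sym {x = x} {y} n∣x-y i =
    subst (_ ∣_) (flip (proj₁ (x i)) (proj₁ (y i))) (∣m⇒∣-m (proj₁ (n∣x-y i))) ,
    subst (_ ∣_) (flip (proj₂ (x i)) (proj₂ (y i))) (∣m⇒∣-m (proj₂ (n∣x-y i)))
    where
    flip : ∀ a b → - (a - b) ≡ b - a
    flip = solve-∀

  ·-cancelʳ : ∀ {a b} {v : Vec2 g} → ¬ (v ≋ zeroV) → (a · v) ≋ (b · v) → a ≡ b
  ·-cancelʳ {a} {b} {v} v≢0 av≋bv with a ℤ.≟ b
  ... | yes a≡b = a≡b
  ... | no  a≢b = ⊥-elim (v≢0 λ i → ×-≡,≡→≡
    (vanish {proj₁ (v i)} (cong proj₁ (av≋bv i)) , vanish {proj₂ (v i)} (cong proj₂ (av≋bv i))))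
    where
    vanish : ∀ {p} → a * p ≡ b * p → p ≡ + 0
    vanish {p} ap≡bp with p ℤ.≟ + 0
    ... | yes p≡0 = p≡0
    ... | no  p≢0 = ⊥-elim (a≢b (ℤ.*-cancelʳ-≡ a b p {{ℤ.≢-nonZero p≢0}} ap≡bp))

module Symplectic {g : ℕ} (d : Fin g → ℕ) where

  private
    term : Vec2 g → Vec2 g → Fin g → ℤ
    term x y i = + d i * (proj₁ (x i) * proj₂ (y i) - proj₂ (x i) * proj₁ (y i))

  form-cong : {x x′ y y′ : Vec2 g} → x ≋ x′ → y ≋ y′ → form d x y ≡ form d x′ y′
  form-cong x≋x′ y≋y′ = Σᶠ-cong λ i →
    cong₂ (λ p q → + d i * (proj₁ p * proj₂ q - proj₂ p * proj₁ q)) (x≋x′ i) (y≋y′ i)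

  form-⊕ˡ : ∀ x x′ y → form d (x ⊕ x′) y ≡ form d x y + form d x′ y
  form-⊕ˡ x x′ y = trans
    (Σᶠ-cong λ i → lin (+ d i) (proj₁ (x i)) (proj₂ (x i)) (proj₁ (x′ i)) (proj₂ (x′ i)) (proj₁ (y i)) (proj₂ (y i)))
    (Σᶠ-+ (term x y) (term x′ y))
    where
    lin : ∀ D a b a′ b′ p q → D * ((a + a′) * q - (b + b′) * p) ≡ D * (a * q - b * p) + D * (a′ * q - b′ * p)
    lin = solve-∀

  form-⊕ʳ : ∀ x y y′ → form d x (y ⊕ y′) ≡ form d x y + form d x y′
  form-⊕ʳ x y y′ = trans
    (Σᶠ-cong λ i → lin (+ d i) (proj₁ (x i)) (proj₂ (x i)) (proj₁ (y i)) (proj₂ (y i)) (proj₁ (y′ i)) (proj₂ (y′ i)))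
    (Σᶠ-+ (term x y) (term x y′))
    where
    lin : ∀ D a b p q p′ q′ → D * (a * (q + q′) - b * (p + p′)) ≡ D * (a * q - b * p) + D * (a * q′ - b * p′)
    lin = solve-∀

  form-·ˡ : ∀ c x y → form d (c · x) y ≡ c * form d x y
  form-·ˡ c x y = trans
    (Σᶠ-cong λ i → lin (+ d i) c (proj₁ (x i)) (proj₂ (x i)) (proj₁ (y i)) (proj₂ (y i)))
    (Σᶠ-* c (term x y))
    where
    lin : ∀ D c a b p q → D * (c * a * q - c * b * p) ≡ c * (D * (a * q - b * p))
    lin = solve-∀

  form-·ʳ : ∀ c x y → form d x (c · y) ≡ c * form d x y
  form-·ʳ c x y = trans
    (Σᶠ-cong λ i → lin (+ d i) c (proj₁ (x i)) (proj₂ (x i)) (proj₁ (y i)) (proj₂ (y i)))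
    (Σᶠ-* c (term x y))
    where
    lin : ∀ D c a b p q → D * (a * (c * q) - b * (c * p)) ≡ c * (D * (a * q - b * p))
    lin = solve-∀

  form-antisym : ∀ x y → form d x y ≡ - form d y x
  form-antisym x y = trans
    (Σᶠ-cong λ i → anti (+ d i) (proj₁ (x i)) (proj₂ (x i)) (proj₁ (y i)) (proj₂ (y i)))
    (Σᶠ-neg (term y x))
    where
    anti : ∀ D a b p q → D * (a * q - b * p) ≡ - (D * (p * b - q * a))
    anti = solve-∀

  form-alternating : ∀ x → form d x x ≡ + 0
  form-alternating x = Σᶠ-zero λ i → alt (+ d i) (proj₁ (x i)) (proj₂ (x i))
    where
    alt : ∀ D a b → D * (a * b - b * a) ≡ + 0
    alt = solve-∀

  form-zeroʳ : ∀ x → form d x zeroV ≡ + 0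
  form-zeroʳ x = Σᶠ-zero λ i → zr (+ d i) (proj₁ (x i)) (proj₂ (x i))
    where
    zr : ∀ D a b → D * (a * + 0 - b * + 0) ≡ + 0
    zr = solve-∀

  -- n ∣ᶠ x says x/n ∈ Λ^∨.
  infix 4 _∣ᶠ_

  _∣ᶠ_ : ℤ → Vec2 g → Set
  n ∣ᶠ x = ∀ y → n ∣ form d x y

  record IsΓMap (f : Vec2 g → Vec2 g) : Set where
    field
      resp-≋             : ∀ {x y} → x ≋ y → f x ≋ f y
      ⊕-homo             : ∀ x y → f (x ⊕ y) ≋ (f x ⊕ f y)
      ·-homo             : ∀ c x → f (c · x) ≋ (c · f x)
      preserves-form     : ∀ x y → form d (f x) (f y) ≡ form d x y
      fixes-discriminant : ∀ {n x} → n ∣ᶠ x → n ∣ᵥ (f x ⊖ x)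

  open IsΓMap public

  ∣ᶠ-preserved : ∀ {f} → IsΓMap f → (∀ y → ∃ λ z → f z ≋ y) → ∀ {n x} → n ∣ᶠ x → n ∣ᶠ f x
  ∣ᶠ-preserved {f} f-isΓ f-onto {x = x} n∣x y with f-onto y
  ... | z , fz≋y =
    subst (_ ∣_) (trans (sym (preserves-form f-isΓ x z)) (form-cong (≋-refl {x = f x}) fz≋y)) (n∣x z)

  IsΓMap-∘ : ∀ {f f′} → IsΓMap f → IsΓMap f′ → (∀ y → ∃ λ z → f z ≋ y) → IsΓMap (f′ ∘ f)
  IsΓMap-∘ {f} {f′} f-isΓ f′-isΓ f-onto = record
    { resp-≋             = λ {x} {y} x≋y → resp-≋ f′-isΓ {f x} {f y} (resp-≋ f-isΓ x≋y)
    ; ⊕-homo             = λ x y → ≋-trans (resp-≋ f′-isΓ {y = f x ⊕ f y} (⊕-homo f-isΓ x y))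
                                           (⊕-homo f′-isΓ (f x) (f y))
    ; ·-homo             = λ c x → ≋-trans (resp-≋ f′-isΓ {y = c · f x} (·-homo f-isΓ c x))
                                           (·-homo f′-isΓ c (f x))
    ; preserves-form     = λ x y → trans (preserves-form f′-isΓ (f x) (f y)) (preserves-form f-isΓ x y)
    ; fixes-discriminant = λ {n} {x} n∣x → ∣ᵥ-⊖-trans {x = f′ (f x)} {f x} {x}
        (fixes-discriminant f′-isΓ (∣ᶠ-preserved f-isΓ f-onto n∣x)) (fixes-discriminant f-isΓ n∣x)
    }

  -- Vectors are compared pointwise, so an element of Γ_Λ carries congruence and an explicit inverse.
  record ΓAut : Set where
    field
      to from  : Vec2 g → Vec2 g
      to-isΓ   : IsΓMap to
      from-isΓ : IsΓMap from
      to-from  : ∀ x → to (from x) ≋ x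
      from-to  : ∀ x → from (to x) ≋ x

  open ΓAut public

  infix  10 _⁻¹
  infixr 9 _∘Γ_

  _⁻¹ : ΓAut → ΓAut
  γ ⁻¹ = record
    { to = from γ ; from = to γ ; to-isΓ = from-isΓ γ ; from-isΓ = to-isΓ γ
    ; to-from = from-to γ ; from-to = to-from γ }

  _∘Γ_ : ΓAut → ΓAut → ΓAut
  γ ∘Γ δ = record
    { to       = to γ ∘ to δ
    ; from     = from δ ∘ from γ
    ; to-isΓ   = IsΓMap-∘ (to-isΓ δ) (to-isΓ γ) (λ y → from δ y , to-from δ y)
    ; from-isΓ = IsΓMap-∘ (from-isΓ γ) (from-isΓ δ) (λ y → to γ y , from-to γ y)
    ; to-from  = λ x → ≋-trans {y = to γ (from γ x)}
        (resp-≋ (to-isΓ γ) {y = from γ x} (to-from δ (from γ x))) (to-from γ x)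
    ; from-to  = λ x → ≋-trans {y = from δ (to δ x)}
        (resp-≋ (from-isΓ δ) {y = to δ x} (from-to γ (to δ x))) (from-to δ x)
    }

  ΓAut⇒InΓ : (γ : ΓAut) → InΓ d (to γ)
  ΓAut⇒InΓ γ =
    ((⊕-homo (to-isΓ γ) , ·-homo (to-isΓ γ)) , (from γ , from-to γ , to-from γ) , preserves-form (to-isΓ γ)) ,
    λ n x _ n∣x → ∣ᵥ⇒∣V (fixes-discriminant (to-isΓ γ) (λ y → ∣ᵤ⇒∣ {+ n} {form d x y} (n∣x y)))

  to-∣ᶠ : ∀ γ {n x} → n ∣ᶠ x → n ∣ᶠ to γ x
  to-∣ᶠ γ = ∣ᶠ-preserved (to-isΓ γ) (λ y → from γ y , to-from γ y)

  images-congruent : ∀ γ δ {n v w} → n ∣ᶠ v → n ∣ᶠ w → n ∣ᵥ (v ⊖ w) → n ∣ᵥ (to γ v ⊖ to δ w)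
  images-congruent γ δ {v = v} {w} n∣v n∣w n∣v-w =
    ∣ᵥ-⊖-trans {x = to γ v} {v} (fixes-discriminant (to-isΓ γ) n∣v)
      (∣ᵥ-⊖-trans {x = v} {w} n∣v-w (∣ᵥ-⊖-sym {x = to δ w} (fixes-discriminant (to-isΓ δ) n∣w)))

  transvection : Vec2 g → ℤ → Vec2 g → Vec2 g
  transvection u c x = x ⊕ ((c * form d x u) · u)

  form-transvectionˡ : ∀ u c x y → form d (transvection u c x) y ≡ form d x y + c * form d x u * form d u y
  form-transvectionˡ u c x y =
    trans (form-⊕ˡ x _ y) (cong (_+_ (form d x y)) (form-·ˡ (c * form d x u) u y))

  form-transvectionʳ : ∀ u c x y → form d x (transvection u c y) ≡ form d x y + c * form d y u * form d x u
  form-transvectionʳ u c x y =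
    trans (form-⊕ʳ x y _) (cong (_+_ (form d x y)) (form-·ʳ (c * form d y u) x u))

  form-transvection-⊥ : ∀ u c x y → form d u y ≡ + 0 → form d (transvection u c x) y ≡ form d x y
  form-transvection-⊥ u c x y u⊥y =
    trans (form-transvectionˡ u c x y)
      (trans (cong (λ t → form d x y + c * form d x u * t) u⊥y) (vanish (form d x y) (c * form d x u)))
    where
    vanish : ∀ a b → a + b * + 0 ≡ a
    vanish = solve-∀

  transvection-⊕ : ∀ u c x y → transvection u c (x ⊕ y) ≋ (transvection u c x ⊕ transvection u c y)
  transvection-⊕ u c x y i = ×-≡,≡→≡
    ( shuffle (proj₁ (x i)) (proj₁ (y i)) (proj₁ (u i)) (form d (x ⊕ y) u) (form-⊕ˡ x y u)
    , shuffle (proj₂ (x i)) (proj₂ (y i)) (proj₂ (u i)) (form d (x ⊕ y) u) (form-⊕ˡ x y u) )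
    where
    shuffle : ∀ a b p s′ → s′ ≡ form d x u + form d y u →
              a + b + c * s′ * p ≡ (a + c * form d x u * p) + (b + c * form d y u * p)
    shuffle a b p _ refl = ring a b c (form d x u) (form d y u) p
      where
      ring : ∀ a b c s t p → a + b + c * (s + t) * p ≡ (a + c * s * p) + (b + c * t * p)
      ring = solve-∀

  transvection-· : ∀ u c a x → transvection u c (a · x) ≋ (a · transvection u c x)
  transvection-· u c a x i = ×-≡,≡→≡
    ( scale (proj₁ (x i)) (proj₁ (u i)) (form d (a · x) u) (form-·ˡ a x u)
    , scale (proj₂ (x i)) (proj₂ (u i)) (form d (a · x) u) (form-·ˡ a x u) )
    where
    scale : ∀ p q s′ → s′ ≡ a * form d x u → a * p + c * s′ * q ≡ a * (p + c * form d x u * q)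
    scale p q _ refl = ring a c p (form d x u) q
      where
      ring : ∀ a c p s q → a * p + c * (a * s) * q ≡ a * (p + c * s * q)
      ring = solve-∀

  transvection-preserves-form : ∀ u c x y → form d (transvection u c x) (transvection u c y) ≡ form d x y
  transvection-preserves-form u c x y = begin
    form d (transvection u c x) (transvection u c y)
      ≡⟨ form-transvectionˡ u c x _ ⟩
    form d x (transvection u c y) + c * form d x u * form d u (transvection u c y)
      ≡⟨ cong₂ (λ s t → s + c * form d x u * t) (form-transvectionʳ u c x y) (form-transvectionʳ u c u y) ⟩
    (form d x y + c * form d y u * form d x u) + c * form d x u * (form d u y + c * form d y u * form d u u)
      ≡⟨ cong₂ (λ s t → (form d x y + c * form d y u * form d x u) + c * form d x u * (s + c * form d y u * t))
               (form-antisym u y) (form-alternating u) ⟩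
    (form d x y + c * form d y u * form d x u) + c * form d x u * (- form d y u + c * form d y u * + 0)
      ≡⟨ cancel (form d x y) c (form d x u) (form d y u) ⟩
    form d x y ∎
    where
    open ≡-Reasoning
    cancel : ∀ b c s t → (b + c * t * s) + c * s * (- t + c * t * + 0) ≡ b
    cancel = solve-∀

  transvection-fixes-discriminant : ∀ u c {n x} → n ∣ᶠ x → n ∣ᵥ (transvection u c x ⊖ x)
  transvection-fixes-discriminant u c {n} {x} n∣x i =
    subst (n ∣_) (difference (proj₁ (x i)) c (form d x u) (proj₁ (u i)))
      (∣n⇒∣m*n (c * proj₁ (u i)) (n∣x u)) ,
    subst (n ∣_) (difference (proj₂ (x i)) c (form d x u) (proj₂ (u i)))
      (∣n⇒∣m*n (c * proj₂ (u i)) (n∣x u))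
    where
    difference : ∀ p c s q → c * q * s ≡ p + c * s * q - p
    difference = solve-∀

  transvection-isΓ : ∀ u c → IsΓMap (transvection u c)
  transvection-isΓ u c = record
    { resp-≋             = λ x≋y → ⊕-cong x≋y (·-congˡ (cong (c *_) (form-cong x≋y (≋-refl {x = u}))))
    ; ⊕-homo             = transvection-⊕ u c
    ; ·-homo             = transvection-· u c
    ; preserves-form     = transvection-preserves-form u c
    ; fixes-discriminant = λ {n} {x} → transvection-fixes-discriminant u c {n} {x}
    }

  transvection-inverse : ∀ u c x → transvection u (- c) (transvection u c x) ≋ x
  transvection-inverse u c x i = ×-≡,≡→≡
    ( cancel (proj₁ (x i)) (proj₁ (u i)) (form d (transvection u c x) u) tx·u
    , cancel (proj₂ (x i)) (proj₂ (u i)) (form d (transvection u c x) u) tx·u )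
    where
    tx·u : form d (transvection u c x) u ≡ form d x u
    tx·u = form-transvection-⊥ u c x u (form-alternating u)
    cancel : ∀ p q s′ → s′ ≡ form d x u → p + c * form d x u * q + - c * s′ * q ≡ p
    cancel p q _ refl = ring p c (form d x u) q
      where
      ring : ∀ p c s q → p + c * s * q + - c * s * q ≡ p
      ring = solve-∀

  transvectionΓ : Vec2 g → ℤ → ΓAut
  transvectionΓ u c = record
    { to       = transvection u c
    ; from     = transvection u (- c)
    ; to-isΓ   = transvection-isΓ u c
    ; from-isΓ = transvection-isΓ u (- c)
    ; to-from  = λ x → subst (λ c′ → transvection u c′ (transvection u (- c) x) ≋ x)
                             (ℤ.neg-involutive c) (transvection-inverse u (- c) x)
    ; from-to  = transvection-inverse u c
    }

  eichler : Vec2 g → Vec2 g → ΓAut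
  eichler e a = transvectionΓ (e ⊕ a) (+ 1) ∘Γ transvectionΓ e (- + 1) ∘Γ transvectionΓ a (- + 1)

  eichler-apply : ∀ e a → form d e a ≡ + 0 →
                  ∀ x → to (eichler e a) x ≋ ((x ⊕ (form d x e · a)) ⊕ (form d x a · e))
  eichler-apply e a e⊥a x i = ×-≡,≡→≡
    ( expand (proj₁ (x i)) (proj₁ (e i)) (proj₁ (a i)) (form d x e) (form d x a)
             (form d x₁ e) (form d x₂ (e ⊕ a)) x₁·e x₂·e⊕a
    , expand (proj₂ (x i)) (proj₂ (e i)) (proj₂ (a i)) (form d x e) (form d x a)
             (form d x₁ e) (form d x₂ (e ⊕ a)) x₁·e x₂·e⊕a )
    where
    x₁ = transvection a (- + 1) x
    x₂ = transvection e (- + 1) x₁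
    a⊥e : form d a e ≡ + 0
    a⊥e = trans (form-antisym a e) (cong -_ e⊥a)
    x₁·e : form d x₁ e ≡ form d x e
    x₁·e = form-transvection-⊥ a (- + 1) x e a⊥e
    x₂·e⊕a : form d x₂ (e ⊕ a) ≡ form d x e + form d x a
    x₂·e⊕a = trans (form-⊕ʳ x₂ e a) (cong₂ _+_
      (trans (form-transvection-⊥ e (- + 1) x₁ e (form-alternating e)) x₁·e)
      (trans (form-transvection-⊥ e (- + 1) x₁ a e⊥a) (form-transvection-⊥ a (- + 1) x a (form-alternating a))))
    expand : ∀ p q r s t s′ F → s′ ≡ s → F ≡ s + t →
             p + - + 1 * t * r + - + 1 * s′ * q + + 1 * F * (q + r) ≡ p + s * r + t * q
    expand p q r s t _ _ refl refl = ring p q r s t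
      where
      ring : ∀ p q r s t → p + - + 1 * t * r + - + 1 * s * q + + 1 * (s + t) * (q + r) ≡ p + s * r + t * q
      ring = solve-∀

  primitive-∣ : ∀ {v} → Primitive d v → ∀ {M N} u → M ≢ + 0 → (M · u) ≋ (N · v) → M ∣ N
  primitive-∣ {v} (v≢0 , saturated) {M} {N} u M≢0 Mu≋Nv =
    let c , u≋cv = saturated u N M M≢0 Mu≋Nv in
    divides c (·-cancelʳ v≢0 λ i → ×-≡,≡→≡
      ( trans (sym (cong proj₁ (Mu≋Nv i)))
              (trans (cong (λ p → M * proj₁ p) (u≋cv i)) (reassociate M c (proj₁ (v i))))
      , trans (sym (cong proj₂ (Mu≋Nv i)))
              (trans (cong (λ p → M * proj₂ p) (u≋cv i)) (reassociate M c (proj₂ (v i))))))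
    where
    reassociate : ∀ M c p → M * (c * p) ≡ c * M * p
    reassociate = solve-∀

  congruent-multiples⇒∣ : ∀ {v w M N} → Primitive d v → M ≢ + 0 → M * N ∣ᵥ (N · v) ⊖ (M · w) → M ∣ N
  congruent-multiples⇒∣ {v} {w} {M} {N} v-prim M≢0 MN∣Nv-Mw =
    primitive-∣ v-prim (w ⊕ (N · z)) M≢0 λ i → ×-≡,≡→≡
      ( cross-multiply (proj₁ (v i)) (proj₁ (w i)) (proj₁ (z i)) (_∣_.equality (proj₁ (MN∣Nv-Mw i)))
      , cross-multiply (proj₂ (v i)) (proj₂ (w i)) (proj₂ (z i)) (_∣_.equality (proj₂ (MN∣Nv-Mw i))) )
    where
    z : Vec2 g
    z i = quotient (proj₁ (MN∣Nv-Mw i)) , quotient (proj₂ (MN∣Nv-Mw i))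
    cross-multiply : ∀ V W Z → N * V - M * W ≡ Z * (M * N) → M * (W + N * Z) ≡ N * V
    cross-multiply V W Z eq = begin
      M * (W + N * Z)            ≡⟨ ring₁ M N W Z ⟩
      M * W + Z * (M * N)        ≡⟨ cong (_+_ (M * W)) eq ⟨
      M * W + (N * V - M * W)    ≡⟨ ring₂ M N V W ⟩
      N * V                      ∎
      where
      open ≡-Reasoning
      ring₁ : ∀ M N W Z → M * (W + N * Z) ≡ M * W + Z * (M * N)
      ring₁ = solve-∀
      ring₂ : ∀ M N V W → M * W + (N * V - M * W) ≡ N * V
      ring₂ = solve-∀

  sameClass⇒≡ : ∀ {v w m n} → Primitive d v → Primitive d w → 0 ℕ.< m → 0 ℕ.< n → SameClass d v m w n → m ≡ n
  sameClass⇒≡ {v} {w} {suc m′} {suc n′} v-prim w-prim _ _ same =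
    ∣-antisym (∣⇒∣ᵤ (congruent-multiples⇒∣ {v} {w} {+ m} {+ n} v-prim (λ ()) mn∣nv-mw))
              (∣⇒∣ᵤ (congruent-multiples⇒∣ {w} {v} {+ n} {+ m} w-prim (λ ()) nm∣mw-nv))
    where
    m = suc m′
    n = suc n′
    mn∣nv-mw : + m * + n ∣ᵥ ((+ n) · v) ⊖ ((+ m) · w)
    mn∣nv-mw = subst (_∣ᵥ ((+ n) · v) ⊖ ((+ m) · w)) (ℤ.pos-* m n)
      (∣V⇒∣ᵥ {x = ((+ n) · v) ⊖ ((+ m) · w)} same)
    nm∣mw-nv : + n * + m ∣ᵥ ((+ m) · w) ⊖ ((+ n) · v)
    nm∣mw-nv = subst (_∣ᵥ ((+ m) · w) ⊖ ((+ n) · v)) (ℤ.*-comm (+ m) (+ n))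
      (∣ᵥ-⊖-sym {x = (+ n) · v} {(+ m) · w} mn∣nv-mw)

  sameClass⇒∣ᵥ : ∀ {v w m} → 0 ℕ.< m → SameClass d v m w m → + m ∣ᵥ v ⊖ w
  sameClass⇒∣ᵥ {v} {w} {suc m′} _ same i =
    cancel {proj₁ (v i)} {proj₁ (w i)} (proj₁ (mm∣mv-mw i)) ,
    cancel {proj₂ (v i)} {proj₂ (w i)} (proj₂ (mm∣mv-mw i))
    where
    m = suc m′
    mm∣mv-mw : + (m ℕ.* m) ∣ᵥ ((+ m) · v) ⊖ ((+ m) · w)
    mm∣mv-mw = ∣V⇒∣ᵥ {x = ((+ m) · v) ⊖ ((+ m) · w)} same
    factor : ∀ M V W → M * V - M * W ≡ M * (V - W)
    factor = solve-∀
    cancel : ∀ {V W} → + (m ℕ.* m) ∣ + m * V - + m * W → + m ∣ V - W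
    cancel {V} {W} mm∣ = *-cancelˡ-∣ (+ m) (subst₂ _∣_ (ℤ.pos-* m m) (factor (+ m) V W) mm∣)

sign-decomposition : ∀ p → ∃[ ε ] (ε * ε ≡ + 1 × p ≡ ε * + ℤ.∣ p ∣)
sign-decomposition (+ n)    = + 1 , refl , sym (ℤ.*-identityˡ (+ n))
sign-decomposition -[1+ n ] = - + 1 , refl , sym (ℤ.-1*i≡-i (+ suc n))

1+*≡*⇒ℤ : ∀ {a b c e} → 1 ℕ.+ a ℕ.* b ≡ c ℕ.* e → + 1 + + a * + b ≡ + c * + e
1+*≡*⇒ℤ {a} {b} {c} {e} eq = begin
  + 1 + + a * + b   ≡⟨ cong (_+_ (+ 1)) (ℤ.pos-* a b) ⟨
  + 1 + + (a ℕ.* b) ≡⟨ ℤ.pos-+ 1 (a ℕ.* b) ⟨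
  + (1 ℕ.+ a ℕ.* b) ≡⟨ cong +_ eq ⟩
  + (c ℕ.* e)       ≡⟨ ℤ.pos-* c e ⟩
  + c * + e         ∎
  where open ≡-Reasoning

bézout-identity⇒ℤ : ∀ {P Q} → Bézout.Identity 1 P Q → ∃[ s ] ∃[ t ] (s * + P + t * + Q ≡ + 1)
bézout-identity⇒ℤ {P} {Q} (Bézout.+- x y eq) =
  + x , - + y , trans (cong (λ t → t + - + y * + Q) (sym (1+*≡*⇒ℤ {y} {Q} {x} {P} eq))) (cancel (+ y) (+ Q))
  where
  cancel : ∀ a b → + 1 + a * b + - a * b ≡ + 1
  cancel = solve-∀
bézout-identity⇒ℤ {P} {Q} (Bézout.-+ x y eq) =
  - + x , + y , trans (cong (λ t → - + x * + P + t) (sym (1+*≡*⇒ℤ {x} {P} {y} {Q} eq))) (cancel (+ x) (+ P))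
  where
  cancel : ∀ a b → - a * b + (+ 1 + a * b) ≡ + 1
  cancel = solve-∀

ℤ-bézout : ∀ p q → ∃[ G ] ∃[ p′ ] ∃[ q′ ] ∃[ s ] ∃[ t ] (p ≡ p′ * G × q ≡ q′ * G × s * p′ + t * q′ ≡ + 1)
ℤ-bézout p q with gcd ℤ.∣ p ∣ ℤ.∣ q ∣ in gcd≡
... | ℕ.zero = + 0 , + 1 , + 0 , + 1 , + 0 ,
  ℤ.∣i∣≡0⇒i≡0 (gcd[m,n]≡0⇒m≡0 gcd≡) , ℤ.∣i∣≡0⇒i≡0 (gcd[m,n]≡0⇒n≡0 ℤ.∣ p ∣ gcd≡) , refl
... | suc _ = coprime-parts {{subst ℕ.NonZero (sym gcd≡) _}}
  where
  coprime-parts : {{_ : ℕ.NonZero (gcd ℤ.∣ p ∣ ℤ.∣ q ∣)}} →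
    ∃[ G ] ∃[ p′ ] ∃[ q′ ] ∃[ s ] ∃[ t ] (p ≡ p′ * G × q ≡ q′ * G × s * p′ + t * q′ ≡ + 1)
  coprime-parts with sign-decomposition p | sign-decomposition q
                   | bézout-identity⇒ℤ (Bézout.identity (GCD-/gcd ℤ.∣ p ∣ ℤ.∣ q ∣))
  ... | σ , σ² , p≡σ∣p∣ | τ , τ² , q≡τ∣q∣ | s , t , s+t≡1 =
    + G , σ * + P , τ * + Q , σ * s , τ * t ,
    factor {p} {σ} {P} p≡σ∣p∣ (m/n*n≡m (gcd[m,n]∣m ℤ.∣ p ∣ ℤ.∣ q ∣)) ,
    factor {q} {τ} {Q} q≡τ∣q∣ (m/n*n≡m (gcd[m,n]∣n ℤ.∣ p ∣ ℤ.∣ q ∣)) ,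
    (begin
      σ * s * (σ * + P) + τ * t * (τ * + Q)         ≡⟨ regroup σ τ s t (+ P) (+ Q) ⟩
      σ * σ * (s * + P) + τ * τ * (t * + Q)         ≡⟨ cong₂ (λ a b → a * (s * + P) + b * (t * + Q)) σ² τ² ⟩
      + 1 * (s * + P) + + 1 * (t * + Q)             ≡⟨ cong₂ _+_ (ℤ.*-identityˡ (s * + P)) (ℤ.*-identityˡ (t * + Q)) ⟩
      s * + P + t * + Q                             ≡⟨ s+t≡1 ⟩
      + 1                                           ∎)
    where
    open ≡-Reasoning
    G = gcd ℤ.∣ p ∣ ℤ.∣ q ∣
    P = ℤ.∣ p ∣ / G
    Q = ℤ.∣ q ∣ / G
    factor : ∀ {r ε R} → r ≡ ε * + ℤ.∣ r ∣ → R ℕ.* G ≡ ℤ.∣ r ∣ → r ≡ ε * + R * + G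
    factor {r} {ε} {R} r≡ R*G≡ = begin
      r                  ≡⟨ r≡ ⟩
      ε * + ℤ.∣ r ∣      ≡⟨ cong (λ n → ε * + n) R*G≡ ⟨
      ε * + (R ℕ.* G)    ≡⟨ cong (ε *_) (ℤ.pos-* R G) ⟩
      ε * (+ R * + G)    ≡⟨ ℤ.*-assoc ε (+ R) (+ G) ⟨
      ε * + R * + G      ∎
    regroup : ∀ σ τ s t a b → σ * s * (σ * a) + τ * t * (τ * b) ≡ σ * σ * (s * a) + τ * τ * (t * b)
    regroup = solve-∀

module Plane₀ {k : ℕ} (d : Fin (suc k) → ℕ) (d₀≡1 : d zero ≡ 1) where

  open Symplectic d

  e₀ f₀ : Vec2 (suc k)
  e₀ zero    = + 1 , + 0
  e₀ (suc i) = + 0 , + 0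
  f₀ zero    = + 0 , + 1
  f₀ (suc i) = + 0 , + 0

  π⊥ : Vec2 (suc k) → Vec2 (suc k)
  π⊥ x zero    = + 0 , + 0
  π⊥ x (suc i) = x (suc i)

  form-split : ∀ x y → form d x y ≡
    (proj₁ (x zero) * proj₂ (y zero) - proj₂ (x zero) * proj₁ (y zero)) + form (d ∘ suc) (x ∘ suc) (y ∘ suc)
  form-split x y = cong (_+ form (d ∘ suc) (x ∘ suc) (y ∘ suc))
    (trans (cong (λ n → + n * (proj₁ (x zero) * proj₂ (y zero) - proj₂ (x zero) * proj₁ (y zero))) d₀≡1)
           (ℤ.*-identityˡ _))

  form-e₀ : ∀ x → form d x e₀ ≡ - proj₂ (x zero)
  form-e₀ x = trans (form-split x e₀)
    (trans (cong (_+_ (proj₁ (x zero) * + 0 - proj₂ (x zero) * + 1)) (Symplectic.form-zeroʳ (d ∘ suc) (x ∘ suc)))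
           (ring (proj₁ (x zero)) (proj₂ (x zero))))
    where
    ring : ∀ p q → p * + 0 - q * + 1 + + 0 ≡ - q
    ring = solve-∀

  form-f₀ : ∀ x → form d x f₀ ≡ proj₁ (x zero)
  form-f₀ x = trans (form-split x f₀)
    (trans (cong (_+_ (proj₁ (x zero) * + 1 - proj₂ (x zero) * + 0)) (Symplectic.form-zeroʳ (d ∘ suc) (x ∘ suc)))
           (ring (proj₁ (x zero)) (proj₂ (x zero))))
    where
    ring : ∀ p q → p * + 1 - q * + 0 + + 0 ≡ p
    ring = solve-∀

  form-π⊥ : ∀ x y → form d x (π⊥ y) ≡ form (d ∘ suc) (x ∘ suc) (y ∘ suc)
  form-π⊥ x y = trans (form-split x (π⊥ y)) (ring (proj₁ (x zero)) (proj₂ (x zero)) _)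
    where
    ring : ∀ p q t → p * + 0 - q * + 0 + t ≡ t
    ring = solve-∀

  e₀⊥π⊥ : ∀ y → form d e₀ (π⊥ y) ≡ + 0
  e₀⊥π⊥ y = trans (form-antisym e₀ (π⊥ y)) (cong -_ (form-e₀ (π⊥ y)))

  f₀⊥π⊥ : ∀ y → form d f₀ (π⊥ y) ≡ + 0
  f₀⊥π⊥ y = trans (form-antisym f₀ (π⊥ y)) (cong -_ (form-f₀ (π⊥ y)))

  ∣ᶠ⇒∣₀ : ∀ {n x} → n ∣ᶠ x → n ∣ proj₁ (x zero) × n ∣ proj₂ (x zero)
  ∣ᶠ⇒∣₀ {n} {x} n∣x =
    subst (n ∣_) (form-f₀ x) (n∣x f₀) ,
    subst (n ∣_) (ℤ.neg-involutive _) (∣m⇒∣-m (subst (n ∣_) (form-e₀ x) (n∣x e₀)))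

  sl₂ : ℤ → ℤ → ℤ → ℤ → Vec2 (suc k) → Vec2 (suc k)
  sl₂ a b c e x zero    = a * proj₁ (x zero) + b * proj₂ (x zero) , c * proj₁ (x zero) + e * proj₂ (x zero)
  sl₂ a b c e x (suc i) = x (suc i)

  sl₂-resp : ∀ a b c e {x y} → x ≋ y → sl₂ a b c e x ≋ sl₂ a b c e y
  sl₂-resp a b c e x≋y zero    = cong (λ p → a * proj₁ p + b * proj₂ p , c * proj₁ p + e * proj₂ p) (x≋y zero)
  sl₂-resp a b c e x≋y (suc i) = x≋y (suc i)

  sl₂-⊕ : ∀ a b c e x y → sl₂ a b c e (x ⊕ y) ≋ (sl₂ a b c e x ⊕ sl₂ a b c e y)
  sl₂-⊕ a b c e x y zero    = ×-≡,≡→≡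
    ( distrib a b (proj₁ (x zero)) (proj₂ (x zero)) (proj₁ (y zero)) (proj₂ (y zero))
    , distrib c e (proj₁ (x zero)) (proj₂ (x zero)) (proj₁ (y zero)) (proj₂ (y zero)) )
    where
    distrib : ∀ a b p q p′ q′ → a * (p + p′) + b * (q + q′) ≡ (a * p + b * q) + (a * p′ + b * q′)
    distrib = solve-∀
  sl₂-⊕ a b c e x y (suc i) = refl

  sl₂-· : ∀ a b c e t x → sl₂ a b c e (t · x) ≋ (t · sl₂ a b c e x)
  sl₂-· a b c e t x zero    = ×-≡,≡→≡
    ( commute a b t (proj₁ (x zero)) (proj₂ (x zero))
    , commute c e t (proj₁ (x zero)) (proj₂ (x zero)) )
    where
    commute : ∀ a b t p q → a * (t * p) + b * (t * q) ≡ t * (a * p + b * q)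
    commute = solve-∀
  sl₂-· a b c e t x (suc i) = refl

  sl₂-preserves-form : ∀ a b c e → a * e - b * c ≡ + 1 → ∀ x y → form d (sl₂ a b c e x) (sl₂ a b c e y) ≡ form d x y
  sl₂-preserves-form a b c e det≡1 x y = cong (_+ form (d ∘ suc) (x ∘ suc) (y ∘ suc)) (begin
    + d zero * ((a * p + b * q) * (c * p′ + e * q′) - (c * p + e * q) * (a * p′ + b * q′))
      ≡⟨ determinant (+ d zero) a b c e p q p′ q′ ⟩
    + d zero * ((a * e - b * c) * (p * q′ - q * p′))
      ≡⟨ cong (λ δ → + d zero * (δ * (p * q′ - q * p′))) det≡1 ⟩
    + d zero * (+ 1 * (p * q′ - q * p′))
      ≡⟨ cong (+ d zero *_) (ℤ.*-identityˡ (p * q′ - q * p′)) ⟩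
    + d zero * (p * q′ - q * p′) ∎)
    where
    open ≡-Reasoning
    p = proj₁ (x zero)
    q = proj₂ (x zero)
    p′ = proj₁ (y zero)
    q′ = proj₂ (y zero)
    determinant : ∀ D a b c e p q p′ q′ →
      D * ((a * p + b * q) * (c * p′ + e * q′) - (c * p + e * q) * (a * p′ + b * q′)) ≡
      D * ((a * e - b * c) * (p * q′ - q * p′))
    determinant = solve-∀

  sl₂-fixes-discriminant : ∀ a b c e {n x} → n ∣ᶠ x → n ∣ᵥ sl₂ a b c e x ⊖ x
  sl₂-fixes-discriminant a b c e {n} {x} n∣x zero =
    let n∣p , n∣q = ∣ᶠ⇒∣₀ {x = x} n∣x in
    subst (n ∣_) (sym (shift a b (proj₁ (x zero)) (proj₂ (x zero))))
      (∣m∣n⇒∣m+n (∣n⇒∣m*n (a - + 1) n∣p) (∣n⇒∣m*n b n∣q)) ,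
    subst (n ∣_) (sym (shift′ c e (proj₁ (x zero)) (proj₂ (x zero))))
      (∣m∣n⇒∣m+n (∣n⇒∣m*n c n∣p) (∣n⇒∣m*n (e - + 1) n∣q))
    where
    shift : ∀ a b p q → a * p + b * q - p ≡ (a - + 1) * p + b * q
    shift = solve-∀
    shift′ : ∀ c e p q → c * p + e * q - q ≡ c * p + (e - + 1) * q
    shift′ = solve-∀
  sl₂-fixes-discriminant a b c e {n} {x} n∣x (suc i) =
    subst (n ∣_) (sym (ℤ.+-inverseʳ (proj₁ (x (suc i))))) (divides (+ 0) refl) ,
    subst (n ∣_) (sym (ℤ.+-inverseʳ (proj₂ (x (suc i))))) (divides (+ 0) refl)

  sl₂-isΓ : ∀ {a b c e} → a * e - b * c ≡ + 1 → IsΓMap (sl₂ a b c e)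
  sl₂-isΓ {a} {b} {c} {e} det≡1 = record
    { resp-≋             = sl₂-resp a b c e
    ; ⊕-homo             = sl₂-⊕ a b c e
    ; ·-homo             = sl₂-· a b c e
    ; preserves-form     = sl₂-preserves-form a b c e det≡1
    ; fixes-discriminant = λ {n} {x} → sl₂-fixes-discriminant a b c e {n} {x}
    }

  sl₂-inverse : ∀ {a b c e} → a * e - b * c ≡ + 1 →
    (∀ x → sl₂ e (- b) (- c) a (sl₂ a b c e x) ≋ x) × (∀ x → sl₂ a b c e (sl₂ e (- b) (- c) a x) ≋ x)
  sl₂-inverse {a} {b} {c} {e} det≡1 = left , right
    where
    unimodular : ∀ p → (a * e - b * c) * p ≡ p
    unimodular p = trans (cong (_* p) det≡1) (ℤ.*-identityˡ p)

    left : ∀ x → sl₂ e (- b) (- c) a (sl₂ a b c e x) ≋ x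
    left x zero    = ×-≡,≡→≡
      ( trans (ring₁ a b c e (proj₁ (x zero)) (proj₂ (x zero))) (unimodular (proj₁ (x zero)))
      , trans (ring₂ a b c e (proj₁ (x zero)) (proj₂ (x zero))) (unimodular (proj₂ (x zero))) )
      where
      ring₁ : ∀ a b c e p q → e * (a * p + b * q) + - b * (c * p + e * q) ≡ (a * e - b * c) * p
      ring₁ = solve-∀
      ring₂ : ∀ a b c e p q → - c * (a * p + b * q) + a * (c * p + e * q) ≡ (a * e - b * c) * q
      ring₂ = solve-∀
    left x (suc i) = refl

    right : ∀ x → sl₂ a b c e (sl₂ e (- b) (- c) a x) ≋ x
    right x zero    = ×-≡,≡→≡
      ( trans (ring₁ a b c e (proj₁ (x zero)) (proj₂ (x zero))) (unimodular (proj₁ (x zero)))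
      , trans (ring₂ a b c e (proj₁ (x zero)) (proj₂ (x zero))) (unimodular (proj₂ (x zero))) )
      where
      ring₁ : ∀ a b c e p q → a * (e * p + - b * q) + b * (- c * p + a * q) ≡ (a * e - b * c) * p
      ring₁ = solve-∀
      ring₂ : ∀ a b c e p q → c * (e * p + - b * q) + e * (- c * p + a * q) ≡ (a * e - b * c) * q
      ring₂ = solve-∀
    right x (suc i) = refl

  sl₂Γ : ∀ a b c e → a * e - b * c ≡ + 1 → ΓAut
  sl₂Γ a b c e det≡1 = record
    { to       = sl₂ a b c e
    ; from     = sl₂ e (- b) (- c) a
    ; to-isΓ   = sl₂-isΓ det≡1
    ; from-isΓ = sl₂-isΓ (trans (adjugate a b c e) det≡1)
    ; to-from  = proj₂ (sl₂-inverse det≡1)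
    ; from-to  = proj₁ (sl₂-inverse det≡1)
    }
    where
    adjugate : ∀ a b c e → e * a - - b * - c ≡ a * e - b * c
    adjugate = solve-∀

  clear-f₀-coefficient : ∀ x → ∃ λ γ → proj₂ (to γ x zero) ≡ + 0
  clear-f₀-coefficient x with ℤ-bézout (proj₁ (x zero)) (proj₂ (x zero))
  ... | G , p′ , q′ , s , t , p≡p′G , q≡q′G , s+t≡1 =
    sl₂Γ s t (- q′) p′ (trans (det s t p′ q′) s+t≡1) ,
    trans (cong₂ (λ p q → - q′ * p + p′ * q) p≡p′G q≡q′G) (annihilate p′ q′ G)
    where
    det : ∀ s t p q → s * p - t * - q ≡ s * p + t * q
    det = solve-∀
    annihilate : ∀ p q G → - q * (p * G) + p * (q * G) ≡ + 0
    annihilate = solve-∀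

  raise-f₀-coefficient : ∀ x y → proj₂ (x zero) ≡ + 0 → ∃ λ γ → proj₂ (to γ x zero) ≡ form d x y
  raise-f₀-coefficient x y x₀₂≡0 = transvectionΓ f₀ (proj₂ (y zero)) ∘Γ eichler f₀ (π⊥ y) , (begin
    proj₂ (transvection f₀ (proj₂ (y zero)) (to (eichler f₀ (π⊥ y)) x) zero)
      ≡⟨ cong proj₂ (resp-≋ (transvection-isΓ f₀ (proj₂ (y zero))) {y = z}
                            (eichler-apply f₀ (π⊥ y) (f₀⊥π⊥ y) x) zero) ⟩
    proj₂ (z zero) + proj₂ (y zero) * form d z f₀ * + 1
      ≡⟨ cong (λ t → proj₂ (z zero) + proj₂ (y zero) * t * + 1) (form-f₀ z) ⟩
    proj₂ (z zero) + proj₂ (y zero) * proj₁ (z zero) * + 1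
      ≡⟨ collect (proj₁ (x zero)) (proj₂ (y zero)) (proj₁ (y zero)) (form d x f₀) x₀₂≡0 (form-π⊥ x y) ⟩
    proj₁ (x zero) * proj₂ (y zero) - proj₂ (x zero) * proj₁ (y zero) + form (d ∘ suc) (x ∘ suc) (y ∘ suc)
      ≡⟨ form-split x y ⟨
    form d x y ∎)
    where
    open ≡-Reasoning
    z = (x ⊕ (form d x f₀ · π⊥ y)) ⊕ (form d x (π⊥ y) · f₀)
    collect : ∀ {q R T} p Y Y′ F → q ≡ + 0 → R ≡ T →
      q + F * + 0 + R * + 1 + Y * (p + F * + 0 + R * + 0) * + 1 ≡ p * Y - q * Y′ + T
    collect {T = T} p Y Y′ F refl refl = ring p Y Y′ F T
      where
      ring : ∀ p Y Y′ F T → + 0 + F * + 0 + T * + 1 + Y * (p + F * + 0 + T * + 0) * + 1 ≡ p * Y - + 0 * Y′ + T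
      ring = solve-∀

  normalise : ∀ x y → ∃ λ γ → proj₂ (to γ x zero) ≡ form d x y
  normalise x y =
    let γ , cleared = clear-f₀-coefficient x
        δ , raised  = raise-f₀-coefficient (to γ x) (to γ y) cleared
    in δ ∘Γ γ , trans raised (preserves-form (to-isΓ γ) x y)

  e₀-shear : ∀ {m} x a N → proj₂ (x zero) ≡ m →
    to (transvectionΓ e₀ N ∘Γ eichler e₀ (π⊥ a)) x ≋ ((x ⊕ ((- m) · π⊥ a)) ⊕ ((form d x (π⊥ a) - N * m) · e₀))
  e₀-shear {m} x a N x₀₂≡m i =
    trans (resp-≋ (transvection-isΓ e₀ N) {y = z} (eichler-apply e₀ (π⊥ a) (e₀⊥π⊥ a) x) i) (×-≡,≡→≡
      ( collect (proj₁ (x i)) (proj₁ (π⊥ a i)) (proj₁ (e₀ i)) (form d x (π⊥ a)) x·e₀ z·e₀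
      , collect (proj₂ (x i)) (proj₂ (π⊥ a i)) (proj₂ (e₀ i)) (form d x (π⊥ a)) x·e₀ z·e₀ ))
    where
    z = (x ⊕ (form d x e₀ · π⊥ a)) ⊕ (form d x (π⊥ a) · e₀)
    x·e₀ : form d x e₀ ≡ - m
    x·e₀ = trans (form-e₀ x) (cong -_ x₀₂≡m)
    z·e₀ : form d z e₀ ≡ - m
    z·e₀ = trans (form-e₀ z) (cong -_ (trans (vanish (proj₂ (x zero)) (form d x e₀) (form d x (π⊥ a))) x₀₂≡m))
      where
      vanish : ∀ p F R → p + F * + 0 + R * + 0 ≡ p
      vanish = solve-∀
    collect : ∀ {F Z} p s t R → F ≡ - m → Z ≡ - m → p + F * s + R * t + N * Z * t ≡ p + - m * s + (R - N * m) * t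
    collect p s t R refl refl = ring p s t R N m
      where
      ring : ∀ p s t R N m → p + - m * s + R * t + N * - m * t ≡ p + - m * s + (R - N * m) * t
      ring = solve-∀

  move-within-class : ∀ {m} x r → m ∣ᶠ x → proj₂ (x zero) ≡ m → proj₂ (r zero) ≡ m → m ∣ᵥ x ⊖ r →
                      ∃ λ γ → to γ x ≋ r
  move-within-class {m} x r m∣x x₀₂≡m r₀₂≡m m∣x-r =
    transvectionΓ e₀ N ∘Γ eichler e₀ (π⊥ q) , ≋-trans (e₀-shear x q N x₀₂≡m) coordinates
    where
    q : Vec2 (suc k)
    q i = quotient (proj₁ (m∣x-r i)) , quotient (proj₂ (m∣x-r i))
    m∣N·m : m ∣ (proj₁ (x zero) - proj₁ (r zero)) + form d x (π⊥ q)
    m∣N·m = ∣m∣n⇒∣m+n (proj₁ (m∣x-r zero)) (m∣x (π⊥ q))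
    N = quotient m∣N·m

    fix-e₀ : ∀ p p′ R → (p - p′) + R ≡ N * m → p + - m * + 0 + (R - N * m) * + 1 ≡ p′
    fix-e₀ p p′ R N·m = begin
      p + - m * + 0 + (R - N * m) * + 1 ≡⟨ ring₁ p R N m ⟩
      p + R - N * m                     ≡⟨ cong (λ t → p + R - t) N·m ⟨
      p + R - ((p - p′) + R)            ≡⟨ ring₂ p p′ R ⟩
      p′                                ∎
      where
      open ≡-Reasoning
      ring₁ : ∀ p R N m → p + - m * + 0 + (R - N * m) * + 1 ≡ p + R - N * m
      ring₁ = solve-∀
      ring₂ : ∀ p p′ R → p + R - ((p - p′) + R) ≡ p′
      ring₂ = solve-∀

    keep-f₀ : ∀ {p p′} T → p ≡ m → p′ ≡ m → p + - m * + 0 + T * + 0 ≡ p′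
    keep-f₀ T refl refl = ring m T
      where
      ring : ∀ m T → m + - m * + 0 + T * + 0 ≡ m
      ring = solve-∀

    shift : ∀ p p′ s T → p - p′ ≡ s * m → p + - m * s + T * + 0 ≡ p′
    shift p p′ s T p-p′≡sm = begin
      p + - m * s + T * + 0 ≡⟨ ring₁ p m s T ⟩
      p - s * m             ≡⟨ cong (_-_ p) p-p′≡sm ⟨
      p - (p - p′)          ≡⟨ ring₂ p p′ ⟩
      p′                    ∎
      where
      open ≡-Reasoning
      ring₁ : ∀ p m s T → p + - m * s + T * + 0 ≡ p - s * m
      ring₁ = solve-∀
      ring₂ : ∀ p p′ → p - (p - p′) ≡ p′
      ring₂ = solve-∀

    coordinates : ((x ⊕ ((- m) · π⊥ q)) ⊕ ((form d x (π⊥ q) - N * m) · e₀)) ≋ r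
    coordinates zero    = ×-≡,≡→≡
      ( fix-e₀ (proj₁ (x zero)) (proj₁ (r zero)) (form d x (π⊥ q)) (_∣_.equality m∣N·m)
      , keep-f₀ {proj₂ (x zero)} {proj₂ (r zero)} (form d x (π⊥ q) - N * m) x₀₂≡m r₀₂≡m )
    coordinates (suc i) = ×-≡,≡→≡
      ( shift (proj₁ (x (suc i))) (proj₁ (r (suc i))) (proj₁ (q (suc i))) (form d x (π⊥ q) - N * m)
              (_∣_.equality (proj₁ (m∣x-r (suc i))))
      , shift (proj₂ (x (suc i))) (proj₂ (r (suc i))) (proj₂ (q (suc i))) (form d x (π⊥ q) - N * m)
              (_∣_.equality (proj₂ (m∣x-r (suc i)))) )

  Γ-transitive : ∀ {m} v w → m ∣ᶠ v → m ∣ᶠ w → (∃ λ y → form d v y ≡ m) → (∃ λ y → form d w y ≡ m) →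
                 m ∣ᵥ (v ⊖ w) → ∃ λ γ → to γ v ≋ w
  Γ-transitive {m} v w m∣v m∣w (y , v·y≡m) (y′ , w·y′≡m) m∣v-w = join (normalise v y) (normalise w y′)
    where
    join : (∃ λ γ → proj₂ (to γ v zero) ≡ form d v y) → (∃ λ δ → proj₂ (to δ w zero) ≡ form d w y′) →
           ∃ λ γ → to γ v ≋ w
    join (γ , γv₀₂≡v·y) (δ , δw₀₂≡w·y′) = finish (move-within-class (to γ v) (to δ w)
      (to-∣ᶠ γ {m} {v} m∣v) (trans γv₀₂≡v·y v·y≡m) (trans δw₀₂≡w·y′ w·y′≡m)
      (images-congruent γ δ {m} {v} {w} m∣v m∣w m∣v-w))
      where
      finish : (∃ λ ε → to ε (to γ v) ≋ to δ w) → ∃ λ γ → to γ v ≋ w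
      finish (ε , εγv≋δw) =
        δ ⁻¹ ∘Γ ε ∘Γ γ , ≋-trans {y = from δ (to δ w)} (resp-≋ (from-isΓ δ) εγv≋δw) (from-to δ w)

open Symplectic using (ΓAut⇒InΓ; sameClass⇒≡; sameClass⇒∣ᵥ; to)

proposition2p4 : (k : ℕ) (d : Fin (suc (suc k)) → ℕ)
    → IsType d → d zero ≡ 1 → d (suc zero) ≡ 1
    → (v w : Vec2 (suc (suc k))) → Primitive d v → Primitive d w
    → (m n : ℕ) → IsDiv d v m → IsDiv d w n
    → SameClass d v m w n
    → ∃ λ γ → InΓ d γ × (γ v ≋ w)
-- Only d₁ = 1 (d zero ≡ 1) is needed.
proposition2p4 k d _ d₀≡1 _ v w v-prim w-prim m n (0<m , m∣v , v·y≡m) (0<n , n∣w , w·y≡n) same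
  with refl ← sameClass⇒≡ d v-prim w-prim 0<m 0<n same =
  conclude (Plane₀.Γ-transitive d d₀≡1 v w
    (λ y → ∣ᵤ⇒∣ {+ m} {form d v y} (m∣v y)) (λ y → ∣ᵤ⇒∣ {+ m} {form d w y} (n∣w y))
    v·y≡m w·y≡n (sameClass⇒∣ᵥ d 0<m same))
  where
  conclude : (∃ λ γ → to γ v ≋ w) → ∃ λ γ → InΓ d γ × (γ v ≋ w)
  conclude (γ , γv≋w) = to γ , ΓAut⇒InΓ d γ , γv≋w
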